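{- Let $\Pi X.\,s\,[\exists\vec{x}.\varphi]$ and $\Pi Y.\,t\,[\exists\vec{y}.\psi]$ be existentially constrained terms. Then $\Pi X.\,s\,[\exists\vec{x}.\varphi]\sim\Pi Y.\,t\,[\exists\vec{y}.\psi]$ if and only if $[\![\Pi X.\,s\,[\exists\vec{x}.\varphi]]\!]_{\mathsf v}=[\![\Pi Y.\,t\,[\exists\vec{y}.\psi]]\!]_{\mathsf v}$.
   Context: Terms are built over a sorted signature whose function symbols are split into theory symbols (whose argument and result sorts are theory sorts) and term symbols, and a set $\mathcal{V}$ of sorted variables; theory sorts and symbols are interpreted in a fixed model $\mathcal{M}$. Every element of the interpretation of each theory sort is a constant symbol, called a value; $\mathcal{V}al$ denotes the set of values. There is a theory sort of Booleans with standard interpretation and the usual connectives. A constraint is a Boolean-sorted term built from theory symbols and variables; a (possibly existentially quantified) formula is valid if it is true under all valuations of its free variables in $\mathcal{M}$. $\mathcal{V}ar(\cdot)$ is the set of variables. A substitution $\sigma$ is a sort-preserving map from variables to terms with finite domain; $\sigma$ is $X$-valued if $\sigma(X)\subseteq\mathcal{V}al$. An existential constraint $\exists\vec{x}.\varphi$ is a sequence of variables $\vec x$ together with a constraint $\varphi$ with $\{\vec x\}\subseteq\mathcal{V}ar(\varphi)$; its free variables are $\mathcal{FV}ar(\exists\vec x.\varphi)=\mathcal{V}ar(\varphi)\setminus\{\vec x\}$. For a substitution $\sigma$, $\sigma\vDash_{\mathcal M}\exists\vec x.\varphi$ means $\sigma$ is $\mathcal{FV}ar(\exists\vec x.\varphi)$-valued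 and $(\exists\vec x.\varphi)\sigma$ is valid. An existentially constrained term $\Pi X.\,s\,[\exists\vec x.\varphi]$ consists of a set $X$ of variables, a term $s$ and an existential constraint with $\mathcal{FV}ar(\exists\vec x.\varphi)\subseteq X\subseteq\mathcal{V}ar(s)$ and $\{\vec x\}\cap\mathcal{V}ar(s)=\emptyset$. Subsumption: $\Pi X.\,s\,[\exists\vec x.\varphi]\precsim\Pi Y.\,t\,[\exists\vec y.\psi]$ holds if for every $X$-valued substitution $\sigma$ with $\sigma\vDash_{\mathcal M}\exists\vec x.\varphi$ there is a $Y$-valued substitution $\gamma$ with $\gamma\vDash_{\mathcal M}\exists\vec y.\psi$ and $s\sigma=t\gamma$. Equivalence $\sim$ means subsumption in both directions. Value interpretation: $[\![\Pi X.\,s\,[\exists\vec x.\varphi]]\!]_{\mathsf v}$ is the set of all terms $s\sigma$ where $\sigma$ is a substitution such that $\sigma(X)\subseteq\mathcal{V}al$, $\sigma(\mathcal{V}ar(s)\setminus X)\subseteq\mathcal V$, $\sigma(x)\neq\sigma(y)$ for distinct $x,y\in\mathcal{V}ar(s)\setminus X$, and $\sigma\vDash_{\mathcal M}\exists\vec x.\varphi$. -}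

module Defs where

open import Data.Bool using (Bool; true; false; T)
open import Data.List using (List; []; _∷_)
open import Data.List.Relation.Unary.All using (All; []; _∷_)
open import Data.List.Relation.Unary.Any using (Any)
open import Data.List.Membership.Propositional using (_∈_; _∉_)
import Data.List.Membership.DecPropositional as DecMem
open import Data.Product using (Σ; ∃; _×_; _,_)
open import Relation.Binary.PropositionalEquality using (_≡_; _≢_; subst; sym)
open import Relation.Binary.Definitions using (DecidableEquality)
open import Relation.Nullary using (yes; no; ¬_)

-- A sorted signature split into theory / term part, together with the
-- fixed model M interpreting theory sorts and (non-value) theory symbols.
-- Values (one constant symbol per element of the interpretation of each
-- theory sort) are added as function symbols in `Fun` below.

record Signature : Set₁ where
  field
    Sort      : Set
    thSort    : Sort → Bool
    ⟦_⟧       : Sort → Set                  -- interpretation (only meaningful for theory sorts)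
    BoolS     : Sort
    BoolS-th  : T (thSort BoolS)
    ⟦Bool⟧    : ⟦ BoolS ⟧ ≡ Bool
    ThFun     : Set
    thArity   : ThFun → List Sort
    thRes     : ThFun → Sort
    thArityTh : (f : ThFun) → All (λ s → T (thSort s)) (thArity f)
    thResTh   : (f : ThFun) → T (thSort (thRes f))
    thInterp  : (f : ThFun) → All ⟦_⟧ (thArity f) → ⟦ thRes f ⟧
    TmFun     : Set
    tmArity   : TmFun → List Sort
    tmRes     : TmFun → Sort
    Var       : Set
    vsort     : Var → Sort
    _≟V_      : DecidableEquality Var

module Framework (Sig : Signature) where
  open Signature Sig public

  ThSort : Sort → Set
  ThSort s = T (thSort s)

  data Fun : Set where
    val : (s : Sort) → ThSort s → ⟦ s ⟧ → Fun
    th  : ThFun → Fun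
    tm  : TmFun → Fun

  arity : Fun → List Sort
  arity (val _ _ _) = []
  arity (th f)      = thArity f
  arity (tm f)      = tmArity f

  res : Fun → Sort
  res (val s _ _) = s
  res (th f)      = thRes f
  res (tm f)      = tmRes f

  data Term : Set where
    var : Var → Term
    app : Fun → List Term → Term

  mutual
    data WS : Term → Sort → Set where
      ws-var : ∀ v → WS (var v) (vsort v)
      ws-app : ∀ f ts → WSs ts (arity f) → WS (app f ts) (res f)

    data WSs : List Term → List Sort → Set where
      []  : WSs [] []
      _∷_ : ∀ {t ts s ss} → WS t s → WSs ts ss → WSs (t ∷ ts) (s ∷ ss)

  -- 𝒱ar(t) as an occurrence predicate
  data _occ_ (v : Var) : Term → Set where
    occ-var : v occ var v
    occ-app : ∀ {f ts} → Any (v occ_) ts → v occ app f ts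

  IsVal : Term → Set
  IsVal t = Σ Sort λ s → Σ (ThSort s) λ p → Σ ⟦ s ⟧ λ a → t ≡ app (val s p a) []

  IsVar : Term → Set
  IsVar t = Σ Var λ w → t ≡ var w

  mutual
    _⟨_⟩ : Term → (Var → Term) → Term
    var v    ⟨ σ ⟩ = σ v
    app f ts ⟨ σ ⟩ = app f (ts ⟨ σ ⟩*)

    _⟨_⟩* : List Term → (Var → Term) → List Term
    []       ⟨ σ ⟩* = []
    (t ∷ ts) ⟨ σ ⟩* = t ⟨ σ ⟩ ∷ ts ⟨ σ ⟩*

  record Subst : Set where
    field
      map    : Var → Term
      sorted : ∀ v → WS (map v) (vsort v)
      dom    : List Var
      finite : ∀ v → v ∉ dom → map v ≡ var v
  open Subst public

  _·_ : Term → Subst → Term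
  t · σ = t ⟨ map σ ⟩

  Valued : (Var → Set) → Subst → Set
  Valued X σ = ∀ v → X v → IsVal (map σ v)

  mutual
    data ThTerm : Term → Set where
      tht-var : ∀ v → ThTerm (var v)
      tht-val : ∀ s p a → ThTerm (app (val s p a) [])
      tht-th  : ∀ f ts → ThTerms ts → ThTerm (app (th f) ts)

    data ThTerms : List Term → Set where
      []  : ThTerms []
      _∷_ : ∀ {t ts} → ThTerm t → ThTerms ts → ThTerms (t ∷ ts)

  IsConstraint : Term → Set
  IsConstraint φ = WS φ BoolS × ThTerm φ

  Valuation : Set
  Valuation = (v : Var) → ThSort (vsort v) → ⟦ vsort v ⟧

  trueB : ⟦ BoolS ⟧
  trueB = subst (λ A → A) (sym ⟦Bool⟧) true

  mutual
    data Eval (ρ : Valuation) : Term → (s : Sort) → ⟦ s ⟧ → Set where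
      ev-var : ∀ v (p : ThSort (vsort v)) → Eval ρ (var v) (vsort v) (ρ v p)
      ev-val : ∀ s p a → Eval ρ (app (val s p a) []) s a
      ev-th  : ∀ f ts as → Evals ρ ts (thArity f) as
             → Eval ρ (app (th f) ts) (thRes f) (thInterp f as)

    data Evals (ρ : Valuation) : List Term → (ss : List Sort) → All ⟦_⟧ ss → Set where
      []  : Evals ρ [] [] []
      _∷_ : ∀ {t ts s ss a as} → Eval ρ t s a → Evals ρ ts ss as
          → Evals ρ (t ∷ ts) (s ∷ ss) (a ∷ as)

  record ExConstraint : Set where
    constructor ∃[_]_∣_,_
    field
      bound   : List Var
      body    : Term
      isCons  : IsConstraint body
      boundOk : ∀ x → x ∈ bound → x occ body
  open ExConstraint public

  FVar : ExConstraint → Var → Set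
  FVar e v = (v occ body e) × (v ∉ bound e)

  Valid : List Var → Term → Set
  Valid xs ψ = (ρ : Valuation) → Σ Valuation λ ρ′ →
               (∀ v p → v ∉ xs → ρ′ v p ≡ ρ v p) × Eval ρ′ ψ BoolS trueB

  open DecMem _≟V_ using (_∈?_)

  -- (∃ x⃗. φ)σ : the bound variables are not substituted
  restrict : List Var → (Var → Term) → Var → Term
  restrict xs σ v with v ∈? xs
  ... | yes _ = var v
  ... | no  _ = σ v

  _⊨_ : Subst → ExConstraint → Set
  σ ⊨ e = Valued (FVar e) σ × Valid (bound e) (body e ⟨ restrict (bound e) (map σ) ⟩)

  record ECTerm : Set where
    field
      X       : List Var
      term    : Term
      sort    : Sort
      wsTerm  : WS term sort
      cons    : ExConstraint
      fv⊆X    : ∀ v → FVar cons v → v ∈ X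
      X⊆var   : ∀ v → v ∈ X → v occ term
      disjoint : ∀ x → x ∈ bound cons → ¬ (x occ term)
  open ECTerm public

  _≾_ : ECTerm → ECTerm → Set
  E ≾ F = (σ : Subst) → Valued (_∈ X E) σ → σ ⊨ cons E →
          Σ Subst λ γ → Valued (_∈ X F) γ × γ ⊨ cons F × (term E · σ ≡ term F · γ)

  _∼_ : ECTerm → ECTerm → Set
  E ∼ F = (E ≾ F) × (F ≾ E)

  -- value interpretation ⟦ Π X. s [∃ x⃗. φ] ⟧ᵥ as a predicate on terms
  ⟦_⟧ᵥ : ECTerm → Term → Set
  ⟦ E ⟧ᵥ u = Σ Subst λ σ →
      Valued (_∈ X E) σ
    × (∀ v → v occ term E → v ∉ X E → IsVar (map σ v))
    × (∀ v w → v occ term E → w occ term E → v ∉ X E → w ∉ X E → v ≢ w → map σ v ≢ map σ w)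
    × σ ⊨ cons E
    × u ≡ term E · σ

  _≐_ : (Term → Set) → (Term → Set) → Set
  A ≐ B = ∀ u → (A u → B u) × (B u → A u)

module Submission where

-- Writing σ|X for σ with every variable outside X sent to itself,
-- σ|X is again admissible and s(σ|X) lies in the value interpretation of
-- Π X. s [∃x⃗.φ]; moreover s σ = s(σ|X)σ. So inclusion of value interpretations
-- gives subsumption by instantiating the witness for s(σ|X) with σ.
-- Conversely, let s σ ∈ ⟦Π X. s [∃x⃗.φ]⟧ᵥ and let γ witness s σ = t γ. Applying
-- the reverse subsumption to γ|Y gives σ₂ with t(γ|Y) = s σ₂, hence
-- s σ = s σ₂ γ. A variable w of t outside Y occurs in t(γ|Y) = s σ₂, so in some
-- σ₂ v with v outside X (values contain no variables); as σ v = σ₂ v γ is a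
-- variable, σ₂ v = w and γ w = σ v. Thus γ inherits from σ the property of
-- renaming the non-value variables injectively.

open import Defs
open import Data.Product using (_×_; Σ; _,_; proj₁; proj₂)
open import Data.Empty using (⊥-elim)
open import Data.List using (List; []; _∷_; _++_)
open import Data.List.Relation.Unary.Any using (Any; here; there)
open import Data.List.Membership.Propositional using (_∈_; _∉_)
open import Data.List.Membership.Propositional.Properties using (∈-++⁺ˡ; ∈-++⁺ʳ)
import Data.List.Membership.DecPropositional as DecMem
open import Data.List.Properties using (∷-injective)
open import Relation.Binary.PropositionalEquality
open import Relation.Nullary using (yes; no; ¬_)

module _ (Sig : Signature) where
  open Framework Sig
  open DecMem _≟V_ using (_∈?_)

  mutual
    ⟨⟩-∘ : ∀ t (f g : Var → Term) → t ⟨ f ⟩ ⟨ g ⟩ ≡ t ⟨ (λ v → f v ⟨ g ⟩) ⟩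
    ⟨⟩-∘ (var v)    f g = refl
    ⟨⟩-∘ (app h ts) f g = cong (app h) (⟨⟩*-∘ ts f g)

    ⟨⟩*-∘ : ∀ ts (f g : Var → Term) → ts ⟨ f ⟩* ⟨ g ⟩* ≡ ts ⟨ (λ v → f v ⟨ g ⟩) ⟩*
    ⟨⟩*-∘ []       f g = refl
    ⟨⟩*-∘ (t ∷ ts) f g = cong₂ _∷_ (⟨⟩-∘ t f g) (⟨⟩*-∘ ts f g)

  mutual
    ⟨⟩-cong-occ : ∀ t {f g : Var → Term} → (∀ v → v occ t → f v ≡ g v) → t ⟨ f ⟩ ≡ t ⟨ g ⟩
    ⟨⟩-cong-occ (var v)    f≗g = f≗g v occ-var
    ⟨⟩-cong-occ (app h ts) f≗g = cong (app h) (⟨⟩*-cong-occ ts (λ v o → f≗g v (occ-app o)))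

    ⟨⟩*-cong-occ : ∀ ts {f g : Var → Term} → (∀ v → Any (v occ_) ts → f v ≡ g v) →
                   ts ⟨ f ⟩* ≡ ts ⟨ g ⟩*
    ⟨⟩*-cong-occ []       f≗g = refl
    ⟨⟩*-cong-occ (t ∷ ts) f≗g =
      cong₂ _∷_ (⟨⟩-cong-occ t (λ v o → f≗g v (here o))) (⟨⟩*-cong-occ ts (λ v o → f≗g v (there o)))

  ⟨⟩-cong : ∀ t {f g : Var → Term} → (∀ v → f v ≡ g v) → t ⟨ f ⟩ ≡ t ⟨ g ⟩
  ⟨⟩-cong t f≗g = ⟨⟩-cong-occ t (λ v _ → f≗g v)

  args : Term → List Term
  args (var _)    = []
  args (app _ ts) = ts

  mutual
    ⟨⟩-injective-occ : ∀ t {f g : Var → Term} → t ⟨ f ⟩ ≡ t ⟨ g ⟩ → ∀ {v} → v occ t → f v ≡ g v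
    ⟨⟩-injective-occ (var v)    eq occ-var     = eq
    ⟨⟩-injective-occ (app h ts) eq (occ-app o) = ⟨⟩*-injective-occ ts (cong args eq) o

    ⟨⟩*-injective-occ : ∀ ts {f g : Var → Term} → ts ⟨ f ⟩* ≡ ts ⟨ g ⟩* →
                        ∀ {v} → Any (v occ_) ts → f v ≡ g v
    ⟨⟩*-injective-occ (t ∷ ts) eq (here o)  = ⟨⟩-injective-occ t (proj₁ (∷-injective eq)) o
    ⟨⟩*-injective-occ (t ∷ ts) eq (there o) = ⟨⟩*-injective-occ ts (proj₂ (∷-injective eq)) o

  mutual
    occ-⟨⟩⁻ : ∀ t (f : Var → Term) {w} → w occ (t ⟨ f ⟩) → Σ Var λ v → v occ t × w occ f v
    occ-⟨⟩⁻ (var v)    f o = v , occ-var , o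
    occ-⟨⟩⁻ (app h ts) f (occ-app o) with occ-⟨⟩*⁻ ts f o
    ... | v , v∈ts , w∈fv = v , occ-app v∈ts , w∈fv

    occ-⟨⟩*⁻ : ∀ ts (f : Var → Term) {w} → Any (w occ_) (ts ⟨ f ⟩*) →
               Σ Var λ v → Any (v occ_) ts × w occ f v
    occ-⟨⟩*⁻ (t ∷ ts) f (here o) with occ-⟨⟩⁻ t f o
    ... | v , v∈t , w∈fv = v , here v∈t , w∈fv
    occ-⟨⟩*⁻ (t ∷ ts) f (there o) with occ-⟨⟩*⁻ ts f o
    ... | v , v∈ts , w∈fv = v , there v∈ts , w∈fv

  mutual
    occ-⟨⟩⁺ : ∀ t (f : Var → Term) {v w} → v occ t → w occ f v → w occ (t ⟨ f ⟩)
    occ-⟨⟩⁺ (var v)    f occ-var     o = o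
    occ-⟨⟩⁺ (app h ts) f (occ-app a) o = occ-app (occ-⟨⟩*⁺ ts f a o)

    occ-⟨⟩*⁺ : ∀ ts (f : Var → Term) {v w} → Any (v occ_) ts → w occ f v → Any (w occ_) (ts ⟨ f ⟩*)
    occ-⟨⟩*⁺ (t ∷ ts) f (here a)  o = here (occ-⟨⟩⁺ t f a o)
    occ-⟨⟩*⁺ (t ∷ ts) f (there a) o = there (occ-⟨⟩*⁺ ts f a o)

  mutual
    WS-⟨⟩ : ∀ {t s} (f : Var → Term) → (∀ v → WS (f v) (vsort v)) → WS t s → WS (t ⟨ f ⟩) s
    WS-⟨⟩ f f-sorted (ws-var v)      = f-sorted v
    WS-⟨⟩ f f-sorted (ws-app g ts w) = ws-app g (ts ⟨ f ⟩*) (WSs-⟨⟩ f f-sorted w)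

    WSs-⟨⟩ : ∀ {ts ss} (f : Var → Term) → (∀ v → WS (f v) (vsort v)) → WSs ts ss → WSs (ts ⟨ f ⟩*) ss
    WSs-⟨⟩ f f-sorted []       = []
    WSs-⟨⟩ f f-sorted (w ∷ ws) = WS-⟨⟩ f f-sorted w ∷ WSs-⟨⟩ f f-sorted ws

  IsVal-⟨⟩ : ∀ {t} (f : Var → Term) → IsVal t → t ⟨ f ⟩ ≡ t
  IsVal-⟨⟩ f (_ , _ , _ , refl) = refl

  IsVal⇒¬occ : ∀ {t w} → IsVal t → ¬ (w occ t)
  IsVal⇒¬occ (_ , _ , _ , refl) (occ-app ())

  IsVar-⟨⟩⁻ : ∀ t (f : Var → Term) {w} → w occ t → IsVar (t ⟨ f ⟩) → t ≡ var w
  IsVar-⟨⟩⁻ (var _)    f occ-var _ = refl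
  IsVar-⟨⟩⁻ (app _ _)  f _       (_ , ())

  var-injective : ∀ {v w} → var v ≡ var w → v ≡ w
  var-injective refl = refl

  restrictTo : List Var → Subst → Subst
  restrictTo xs σ = record
    { map    = σ|xs
    ; sorted = sorted′
    ; dom    = dom σ
    ; finite = finite′
    }
    where
    σ|xs : Var → Term
    σ|xs v with v ∈? xs
    ... | yes _ = map σ v
    ... | no  _ = var v

    sorted′ : ∀ v → WS (σ|xs v) (vsort v)
    sorted′ v with v ∈? xs
    ... | yes _ = sorted σ v
    ... | no  _ = ws-var v

    finite′ : ∀ v → v ∉ dom σ → σ|xs v ≡ var v
    finite′ v v∉dom with v ∈? xs
    ... | yes _ = finite σ v v∉dom
    ... | no  _ = refl

  restrictTo-∈ : ∀ xs σ {v} → v ∈ xs → map (restrictTo xs σ) v ≡ map σ v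
  restrictTo-∈ xs σ {v} v∈ with v ∈? xs
  ... | yes _  = refl
  ... | no v∉ = ⊥-elim (v∉ v∈)

  restrictTo-∉ : ∀ xs σ {v} → v ∉ xs → map (restrictTo xs σ) v ≡ var v
  restrictTo-∉ xs σ {v} v∉ with v ∈? xs
  ... | yes v∈ = ⊥-elim (v∉ v∈)
  ... | no  _  = refl

  restrictTo-⟨⟩ : ∀ xs σ → Valued (_∈ xs) σ → ∀ v → map (restrictTo xs σ) v ⟨ map σ ⟩ ≡ map σ v
  restrictTo-⟨⟩ xs σ σ-valued v with v ∈? xs
  ... | yes v∈ = IsVal-⟨⟩ (map σ) (σ-valued v v∈)
  ... | no  _  = refl

  _≫_ : Subst → Subst → Subst
  γ ≫ σ = record
    { map    = λ v → map γ v ⟨ map σ ⟩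
    ; sorted = λ v → WS-⟨⟩ (map σ) (sorted σ) (sorted γ v)
    ; dom    = dom γ ++ dom σ
    ; finite = finite′
    }
    where
    finite′ : ∀ v → v ∉ dom γ ++ dom σ → map γ v ⟨ map σ ⟩ ≡ var v
    finite′ v v∉ rewrite finite γ v (λ v∈ → v∉ (∈-++⁺ˡ v∈)) =
      finite σ v (λ v∈ → v∉ (∈-++⁺ʳ (dom γ) v∈))

  ≫-⟨⟩ : ∀ t γ σ → t · (γ ≫ σ) ≡ (t · γ) · σ
  ≫-⟨⟩ t γ σ = sym (⟨⟩-∘ t (map γ) (map σ))

  ⊨-cong : ∀ e σ τ → (∀ v → FVar e v → map σ v ≡ map τ v) → σ ⊨ e → τ ⊨ e
  ⊨-cong e σ τ σ≗τ (σ-valued , σ-valid) =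
    (λ v fv → subst IsVal (σ≗τ v fv) (σ-valued v fv)) ,
    subst (Valid (bound e)) (⟨⟩-cong-occ (body e) restrict≗) σ-valid
    where
    restrict≗ : ∀ v → v occ body e → restrict (bound e) (map σ) v ≡ restrict (bound e) (map τ) v
    restrict≗ v v∈φ with v ∈? bound e
    ... | yes _  = refl
    ... | no v∉ = σ≗τ v (v∈φ , v∉)

  Admissible : ECTerm → Subst → Set
  Admissible E σ = Valued (_∈ X E) σ × σ ⊨ cons E

  Admissible-cong : ∀ E σ τ → (∀ v → v ∈ X E → map σ v ≡ map τ v) →
                    Admissible E σ → Admissible E τ
  Admissible-cong E σ τ σ≗τ (σ-valued , σ⊨) =
    (λ v v∈X → subst IsVal (σ≗τ v v∈X) (σ-valued v v∈X)) ,
    ⊨-cong (cons E) σ τ (λ v fv → σ≗τ v (fv⊆X E v fv)) σ⊨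

  restrictTo-Admissible : ∀ E σ → Admissible E σ → Admissible E (restrictTo (X E) σ)
  restrictTo-Admissible E σ =
    Admissible-cong E σ (restrictTo (X E) σ) (λ v v∈X → sym (restrictTo-∈ (X E) σ v∈X))

  restrictTo-∈⟦⟧ᵥ : ∀ E σ → Admissible E σ → ⟦ E ⟧ᵥ (term E · restrictTo (X E) σ)
  restrictTo-∈⟦⟧ᵥ E σ adm =
    σ₀ , proj₁ σ₀-adm , σ₀-var , σ₀-distinct , proj₂ σ₀-adm , refl
    where
    σ₀ = restrictTo (X E) σ
    σ₀-adm = restrictTo-Admissible E σ adm

    σ₀-var : ∀ v → v occ term E → v ∉ X E → IsVar (map σ₀ v)
    σ₀-var v _ v∉ = v , restrictTo-∉ (X E) σ v∉

    σ₀-distinct : ∀ v w → v occ term E → w occ term E → v ∉ X E → w ∉ X E →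
                  v ≢ w → map σ₀ v ≢ map σ₀ w
    σ₀-distinct v w _ _ v∉ w∉ v≢w eq = v≢w (var-injective (begin
      var v       ≡⟨ sym (restrictTo-∉ (X E) σ v∉) ⟩
      map σ₀ v    ≡⟨ eq ⟩
      map σ₀ w    ≡⟨ restrictTo-∉ (X E) σ w∉ ⟩
      var w       ∎))
      where open ≡-Reasoning

  ⟦⟧ᵥ-⊆⇒≾ : ∀ E F → (∀ u → ⟦ E ⟧ᵥ u → ⟦ F ⟧ᵥ u) → E ≾ F
  ⟦⟧ᵥ-⊆⇒≾ E F E⊆F σ σ-valued σ⊨
    with E⊆F _ (restrictTo-∈⟦⟧ᵥ E σ (σ-valued , σ⊨))
  ... | γ₀ , γ₀-valued , _ , _ , γ₀⊨ , s·σ₀≡t·γ₀ =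
    γ₀ ≫ σ , proj₁ γ-adm , proj₂ γ-adm , s·σ≡t·γ
    where
    γ₀≗γ : ∀ v → v ∈ X F → map γ₀ v ≡ map (γ₀ ≫ σ) v
    γ₀≗γ v v∈Y = sym (IsVal-⟨⟩ (map σ) (γ₀-valued v v∈Y))

    γ-adm : Admissible F (γ₀ ≫ σ)
    γ-adm = Admissible-cong F γ₀ (γ₀ ≫ σ) γ₀≗γ (γ₀-valued , γ₀⊨)

    s·σ≡t·γ : term E · σ ≡ term F · (γ₀ ≫ σ)
    s·σ≡t·γ = begin
      term E · σ                           ≡⟨ ⟨⟩-cong (term E) (restrictTo-⟨⟩ (X E) σ σ-valued) ⟨
      term E · (restrictTo (X E) σ ≫ σ)    ≡⟨ ≫-⟨⟩ (term E) (restrictTo (X E) σ) σ ⟩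
      (term E · restrictTo (X E) σ) · σ    ≡⟨ cong (_· σ) s·σ₀≡t·γ₀ ⟩
      (term F · γ₀) · σ                    ≡⟨ ≫-⟨⟩ (term F) γ₀ σ ⟨
      term F · (γ₀ ≫ σ)                    ∎
      where open ≡-Reasoning

  ≾-antisym⇒⟦⟧ᵥ-⊆ : ∀ E F → E ≾ F → F ≾ E → ∀ u → ⟦ E ⟧ᵥ u → ⟦ F ⟧ᵥ u
  ≾-antisym⇒⟦⟧ᵥ-⊆ E F E≾F F≾E _ (σ , σ-valued , σ-var , σ-distinct , σ⊨ , refl)
    with E≾F σ σ-valued σ⊨
  ... | γ , γ-valued , γ⊨ , s·σ≡t·γ
    with F≾E (restrictTo (X F) γ) (proj₁ γ₁-adm) (proj₂ γ₁-adm)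
    where γ₁-adm = restrictTo-Admissible F γ (γ-valued , γ⊨)
  ... | σ₂ , σ₂-valued , _ , t·γ₁≡s·σ₂ =
    γ , γ-valued , γ-var , γ-distinct , γ⊨ , s·σ≡t·γ
    where
    γ₁ = restrictTo (X F) γ

    s·σ₂≫γ≡s·σ : term E · (σ₂ ≫ γ) ≡ term E · σ
    s·σ₂≫γ≡s·σ = begin
      term E · (σ₂ ≫ γ)    ≡⟨ ≫-⟨⟩ (term E) σ₂ γ ⟩
      (term E · σ₂) · γ    ≡⟨ cong (_· γ) t·γ₁≡s·σ₂ ⟨
      (term F · γ₁) · γ    ≡⟨ ≫-⟨⟩ (term F) γ₁ γ ⟨
      term F · (γ₁ ≫ γ)    ≡⟨ ⟨⟩-cong (term F) (restrictTo-⟨⟩ (X F) γ γ-valued) ⟩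
      term F · γ           ≡⟨ s·σ≡t·γ ⟨
      term E · σ           ∎
      where open ≡-Reasoning

    σ₂≫γ≗σ : ∀ {v} → v occ term E → map σ₂ v ⟨ map γ ⟩ ≡ map σ v
    σ₂≫γ≗σ = ⟨⟩-injective-occ (term E) s·σ₂≫γ≡s·σ

    preimage : ∀ w → w occ term F → w ∉ X F →
               Σ Var λ v → v occ term E × v ∉ X E × map σ₂ v ≡ var w
    preimage w w∈t w∉Y
      with occ-⟨⟩⁻ (term E) (map σ₂)
             (subst (w occ_) t·γ₁≡s·σ₂
               (occ-⟨⟩⁺ (term F) (map γ₁) w∈t
                 (subst (w occ_) (sym (restrictTo-∉ (X F) γ w∉Y)) occ-var)))
    ... | v , v∈s , w∈σ₂v with v ∈? X E
    ...   | yes v∈X = ⊥-elim (IsVal⇒¬occ (σ₂-valued v v∈X) w∈σ₂v)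
    ...   | no  v∉X = v , v∈s , v∉X ,
            IsVar-⟨⟩⁻ (map σ₂ v) (map γ) w∈σ₂v
              (subst IsVar (sym (σ₂≫γ≗σ v∈s)) (σ-var v v∈s v∉X))

    γ≗σ : ∀ {w v} → v occ term E → map σ₂ v ≡ var w → map γ w ≡ map σ v
    γ≗σ v∈s σ₂v≡w = trans (cong (_⟨ map γ ⟩) (sym σ₂v≡w)) (σ₂≫γ≗σ v∈s)

    γ-var : ∀ w → w occ term F → w ∉ X F → IsVar (map γ w)
    γ-var w w∈t w∉Y with preimage w w∈t w∉Y
    ... | v , v∈s , v∉X , σ₂v≡w = subst IsVar (sym (γ≗σ v∈s σ₂v≡w)) (σ-var v v∈s v∉X)

    γ-distinct : ∀ w w′ → w occ term F → w′ occ term F → w ∉ X F → w′ ∉ X F →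
                 w ≢ w′ → map γ w ≢ map γ w′
    γ-distinct w w′ w∈t w′∈t w∉Y w′∉Y w≢w′ γw≡γw′
      with preimage w w∈t w∉Y | preimage w′ w′∈t w′∉Y
    ... | v , v∈s , v∉X , σ₂v≡w | v′ , v′∈s , v′∉X , σ₂v′≡w′ =
      σ-distinct v v′ v∈s v′∈s v∉X v′∉X
        (λ { refl → w≢w′ (var-injective (trans (sym σ₂v≡w) σ₂v′≡w′)) })
        (trans (sym (γ≗σ v∈s σ₂v≡w)) (trans γw≡γw′ (γ≗σ v′∈s σ₂v′≡w′)))

theorem5p6 : (Sig : Signature) → let open Framework Sig in
    (E F : ECTerm) → ((E ∼ F) → (⟦ E ⟧ᵥ ≐ ⟦ F ⟧ᵥ)) × ((⟦ E ⟧ᵥ ≐ ⟦ F ⟧ᵥ) → (E ∼ F))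
theorem5p6 Sig E F = ∼⇒≐ , ≐⇒∼
  where
  open Framework Sig

  ∼⇒≐ : E ∼ F → ⟦ E ⟧ᵥ ≐ ⟦ F ⟧ᵥ
  ∼⇒≐ (E≾F , F≾E) u =
    ≾-antisym⇒⟦⟧ᵥ-⊆ Sig E F E≾F F≾E u , ≾-antisym⇒⟦⟧ᵥ-⊆ Sig F E F≾E E≾F u

  ≐⇒∼ : ⟦ E ⟧ᵥ ≐ ⟦ F ⟧ᵥ → E ∼ F
  ≐⇒∼ E≐F = ⟦⟧ᵥ-⊆⇒≾ Sig E F (λ u → proj₁ (E≐F u)) , ⟦⟧ᵥ-⊆⇒≾ Sig F E (λ u → proj₂ (E≐F u))
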